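{- Let $\pi\colon X\to X_0$ be a Hausdorff étale space. Then the difference–restriction algebra $K(\pi)$ is finitarily compatibly complete.
   Context: An étale space is a surjective local homeomorphism $\pi\colon X\to X_0$ (each $x\in X$ has an open neighbourhood $U$ with $\pi(U)$ open and $\pi|_U\colon U\to\pi(U)$ a homeomorphism); it is Hausdorff if $X$ is. $K(\pi)$ denotes the set of compact open subsets $U\subseteq X$ with $\pi|_U$ injective, with operations $U-V$ (set difference) and $U\rhd V=\pi^{ -1}(\pi(U))\cap V$; it is a difference–restriction algebra (an algebra isomorphic to an algebra of partial functions under relative complement and domain restriction $f\rhd g=\{(x,y)\in g:x\in\mathrm{dom}(f)\}$). In such an algebra put $a\cdot b:=a-(a-b)$, with order $a\le b$ iff $a\cdot b=a$ (in $K(\pi)$ this is inclusion). Elements $a,b$ are compatible if $a\rhd b=b\rhd a$; the algebra is finitarily compatibly complete if every finite set of pairwise compatible elements has a join with respect to $\le$. -}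

module Defs where

open import Level using (0ℓ)
open import Data.Unit using (⊤)
open import Data.Empty using (⊥)
open import Data.Product using (Σ; ∃; ∃-syntax; _×_; _,_)
open import Data.List using (List)
open import Data.List.Membership.Propositional using (_∈_)
open import Data.Fin using (Fin)
open import Data.Nat using (ℕ)
open import Relation.Nullary using (¬_)
open import Relation.Binary.PropositionalEquality using (_≡_; _≢_)
open import Relation.Unary using (Pred; _⊆_; _≐_; _∩_; _∉_)
  renaming (_∈_ to _∈ₚ_)

record Topology (X : Set) : Set₁ where
  field
    IsOpen    : Pred X 0ℓ → Set
    open-resp : ∀ {U V} → U ≐ V → IsOpen U → IsOpen V
    open-univ : IsOpen (λ _ → ⊤)
    open-∩    : ∀ {U V} → IsOpen U → IsOpen V → IsOpen (U ∩ V)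
    open-⋃    : (I : Set) (F : I → Pred X 0ℓ) →
                (∀ i → IsOpen (F i)) → IsOpen (λ x → ∃[ i ] (x ∈ₚ F i))

open Topology public

⋃List : {X I : Set} → (I → Pred X 0ℓ) → List I → Pred X 0ℓ
⋃List F is x = ∃[ i ] (i ∈ is × x ∈ₚ F i)

IsCompact : {X : Set} → Topology X → Pred X 0ℓ → Set₁
IsCompact {X} τ K =
  (I : Set) (F : I → Pred X 0ℓ) → (∀ i → IsOpen τ (F i)) →
  K ⊆ (λ x → ∃[ i ] (x ∈ₚ F i)) →
  ∃[ is ] (K ⊆ ⋃List F is)

IsHausdorff : {X : Set} → Topology X → Set₁
IsHausdorff {X} τ =
  ∀ (x y : X) → x ≢ y →
  ∃[ U ] ∃[ V ] (IsOpen τ U × IsOpen τ V × x ∈ₚ U × y ∈ₚ V ×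
                 (∀ z → z ∈ₚ U → z ∈ₚ V → ⊥))

image : {X Y : Set} → (X → Y) → Pred X 0ℓ → Pred Y 0ℓ
image f U y = ∃[ x ] (x ∈ₚ U × f x ≡ y)

preimage : {X Y : Set} → (X → Y) → Pred Y 0ℓ → Pred X 0ℓ
preimage f W x = f x ∈ₚ W

InjectiveOn : {X Y : Set} → (X → Y) → Pred X 0ℓ → Set
InjectiveOn f U = ∀ {x y} → x ∈ₚ U → y ∈ₚ U → f x ≡ f y → x ≡ y

-- For an open U ⊆ X with π(U) open in X₀, π|U : U → π(U) is a
-- homeomorphism of subspaces: bijective (injective on U, onto π(U) by
-- definition of the image), continuous (preimages of opens of π(U),
-- i.e. of opens W of X₀, are opens of U, i.e. π⁻¹(W) ∩ U open in X),
-- and open (opens of U, i.e. opens V ⊆ U of X, map to opens of X₀).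
HomeoOnto : {X Y : Set} → Topology X → Topology Y → (X → Y) →
            Pred X 0ℓ → Set₁
HomeoOnto {X} {Y} τ σ f U =
  InjectiveOn f U ×
  (∀ (W : Pred Y 0ℓ) → IsOpen σ W → IsOpen τ (preimage f W ∩ U)) ×
  (∀ (V : Pred X 0ℓ) → IsOpen τ V → V ⊆ U → IsOpen σ (image f V))

record IsEtale {X X₀ : Set} (τ : Topology X) (τ₀ : Topology X₀)
               (π : X → X₀) : Set₁ where
  field
    surjective : ∀ (y : X₀) → ∃[ x ] (π x ≡ y)
    local-homeo : ∀ (x : X) → ∃[ U ] (IsOpen τ U × x ∈ₚ U ×
                     IsOpen τ₀ (image π U) × HomeoOnto τ τ₀ π U)

module _ {X X₀ : Set} (τ : Topology X) (π : X → X₀) where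

  record KElem : Set₁ where
    constructor kelem
    field
      set     : Pred X 0ℓ
      isOpen  : IsOpen τ set
      compact : IsCompact τ set
      inj     : InjectiveOn π set

  open KElem public

  _−ₛ_ : Pred X 0ℓ → Pred X 0ℓ → Pred X 0ℓ
  (U −ₛ V) x = x ∈ₚ U × x ∉ V

  _▷ₛ_ : Pred X 0ℓ → Pred X 0ℓ → Pred X 0ℓ
  U ▷ₛ V = preimage π (image π U) ∩ V

  _·ₛ_ : Pred X 0ℓ → Pred X 0ℓ → Pred X 0ℓ
  U ·ₛ V = U −ₛ (U −ₛ V)

  -- a ≤ b iff a · b = a   (equality of elements = equality of subsets)
  _≤K_ : KElem → KElem → Set
  a ≤K b = (set a ·ₛ set b) ≐ set a

  Compatible : KElem → KElem → Set
  Compatible a b = (set a ▷ₛ set b) ≐ (set b ▷ₛ set a)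

  IsJoin : {n : ℕ} → (Fin n → KElem) → KElem → Set₁
  IsJoin F j = (∀ i → F i ≤K j) × (∀ (c : KElem) → (∀ i → F i ≤K c) → j ≤K c)

  FinitarilyCompatiblyComplete : Set₁
  FinitarilyCompatiblyComplete =
    ∀ (n : ℕ) (F : Fin n → KElem) →
    (∀ i j → Compatible (F i) (F j)) → ∃[ j ] IsJoin F j

module Submission where

-- The join of pairwise compatible a₁, …, aₙ is their union. A finite union
-- of compact opens is compact open, and compatibility makes π injective on
-- the union: if x ∈ aᵢ, y ∈ aⱼ and π x ≡ π y, then y ∈ aᵢ ▷ aⱼ = aⱼ ▷ aᵢ ⊆ aᵢ,
-- so x ≡ y by injectivity on aᵢ.

open import Defs
open import Level using (0ℓ)
open import Data.Product using (∃-syntax; _,_; proj₁; proj₂)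
open import Data.List using (List; concat; tabulate)
open import Data.List.Membership.Propositional.Properties
  using (∈-concat⁺′; ∈-tabulate⁺)
open import Data.Fin using (Fin)
open import Function using (_∘_)
open import Relation.Nullary using (¬_)
open import Relation.Binary.PropositionalEquality using (_≡_)
open import Relation.Unary using (Pred; ⋃; _⊆_) renaming (_∈_ to _∈ₚ_)

module _ {X : Set} (τ : Topology X) where

  ⋃-isCompact : ∀ {n} (K : Fin n → Pred X 0ℓ) → (∀ i → IsCompact τ (K i)) →
                IsCompact τ (⋃ (Fin n) K)
  ⋃-isCompact {n} K K-compact I G G-open cover =
    concat (tabulate subcover) , λ { (i , x∈Kᵢ) → covered i x∈Kᵢ }
    where
    finiteSubcover : ∀ i → ∃[ is ] (K i ⊆ ⋃List G is)
    finiteSubcover i = K-compact i I G G-open (λ x∈Kᵢ → cover (i , x∈Kᵢ))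

    subcover : Fin n → List I
    subcover = proj₁ ∘ finiteSubcover

    covered : ∀ i {x} → x ∈ₚ K i → x ∈ₚ ⋃List G (concat (tabulate subcover))
    covered i x∈Kᵢ with proj₂ (finiteSubcover i) x∈Kᵢ
    ... | j , j∈subcover , x∈Gⱼ = j , ∈-concat⁺′ j∈subcover (∈-tabulate⁺ i) , x∈Gⱼ

module _ {X X₀ : Set} (τ : Topology X) (π : X → X₀) where

  compatible⇒fibre-closed : ∀ a b {x y} → Compatible τ π a b →
    x ∈ₚ set a → y ∈ₚ set b → π x ≡ π y → y ∈ₚ set a
  compatible⇒fibre-closed _ _ a▷b≐b▷a x∈a y∈b πx≡πy =
    proj₂ (proj₁ a▷b≐b▷a ((_ , x∈a , πx≡πy) , y∈b))

  ⋃-injectiveOn : ∀ {n} (F : Fin n → KElem τ π) →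
    (∀ i j → Compatible τ π (F i) (F j)) → InjectiveOn π (⋃ (Fin n) (set ∘ F))
  ⋃-injectiveOn F compatible {y = y} (i , x∈Fᵢ) (j , y∈Fⱼ) πx≡πy =
    inj (F i) x∈Fᵢ y∈Fᵢ πx≡πy
    where
    y∈Fᵢ : y ∈ₚ set (F i)
    y∈Fᵢ = compatible⇒fibre-closed (F i) (F j) (compatible i j) x∈Fᵢ y∈Fⱼ πx≡πy

  -- a ≤K b asserts only that a − b is empty, i.e. a ⊆ b up to double negation.
  ¬¬-⊆⇒≤K : ∀ a b → (∀ {x} → x ∈ₚ set a → ¬ ¬ x ∈ₚ set b) → _≤K_ τ π a b
  ¬¬-⊆⇒≤K _ _ a⊆¬¬b = proj₁ , λ x∈a → x∈a , λ { (_ , x∉b) → a⊆¬¬b x∈a x∉b }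

  ≤K⇒¬¬-⊆ : ∀ a b → _≤K_ τ π a b → ∀ {x} → x ∈ₚ set a → ¬ ¬ x ∈ₚ set b
  ≤K⇒¬¬-⊆ _ _ (_ , a⊆a·b) x∈a x∉b = proj₂ (a⊆a·b x∈a) (x∈a , x∉b)

  ⋃K : ∀ {n} (F : Fin n → KElem τ π) → (∀ i j → Compatible τ π (F i) (F j)) →
       KElem τ π
  ⋃K F compatible = kelem (⋃ _ (set ∘ F))
    (open-⋃ τ _ (set ∘ F) (isOpen ∘ F))
    (⋃-isCompact τ (set ∘ F) (compact ∘ F))
    (⋃-injectiveOn F compatible)

  ⋃K-isJoin : ∀ {n} (F : Fin n → KElem τ π)
    (compatible : ∀ i j → Compatible τ π (F i) (F j)) → IsJoin τ π F (⋃K F compatible)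
  ⋃K-isJoin F compatible =
    (λ i → ¬¬-⊆⇒≤K (F i) (⋃K F compatible) λ x∈Fᵢ x∉⋃ → x∉⋃ (i , x∈Fᵢ)) ,
    (λ c F≤c → ¬¬-⊆⇒≤K (⋃K F compatible) c
                 λ { (i , x∈Fᵢ) → ≤K⇒¬¬-⊆ (F i) c (F≤c i) x∈Fᵢ })

lemma4p13 : {X X₀ : Set} (τ : Topology X) (τ₀ : Topology X₀) (π : X → X₀) →
    IsEtale τ τ₀ π → IsHausdorff τ → FinitarilyCompatiblyComplete τ π
lemma4p13 τ τ₀ π _ _ n F compatible = ⋃K τ π F compatible , ⋃K-isJoin τ π F compatible
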